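{- Let $G$ be a graph with source $s$ and weights $w>0$, let $I$ be the interval set induced by running Dijkstra's algorithm on $(G,w)$, and let $C$ be an arbitrary intersecting coloring of $I$. Then $$\log(\mathrm{Lin}(G))\ge\log\big(\mathrm{Lin}(T^{G,w}_{explore})\big)=\Omega(\mathcal{E}(C)).$$
   Context: $G$ is directed or undirected; undirected graphs are connected, in directed graphs every vertex is reachable from $s$. Dijkstra's algorithm (version considered) uses a priority queue: insert $s$ with key $0$; while vertices remain, extract the minimum $(d_u,u)$, output $u$, and for each edge $uv$ with $v$ not yet extracted, insert $v$ (key $+\infty$) if not yet inserted, set $D[v]\gets\min(D[v],d_u+w(uv))$ and decrease the key of $v$ to $D[v]$. The exploration tree $T^{G,w}_{explore}$ is the tree rooted at $s$ in which the parent of each $v\neq s$ is the vertex during whose processing (after whose extraction) $v$ was first inserted into the priority queue. Interval set induced by the run: time is measured as the number of \textsc{Insert} and \textsc{ExtractMin} operations performed so far; each vertex $v$ gives the closed interval $\iota(v)=[\ell,r]$, where $\ell$ is the time $v$ was inserted and $r$ the time it was extracted. An intersecting coloring of an interval set $I$ with $k$ colors is a map $C:I\to\{1,\dots,k\}$ such that for each color the intersection of all intervals of that color is nonempty; with $c_i$ the number of intervals of color $i$, its energy is $\mathcal{E}(C)=2\sum_{i=1}^k c_i\log c_i$. A spanning tree of $G$ is rooted at $s$ (directed away from $s$ for directed $G$); a linearization of a rooted tree is a linear order of its vertices in which no vertex precedes one of its ancestors; a linearization of $G$ is a linearization of some spanning tree of $G$; $\mathrm{Lin}(\cdot)$ counts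 linearizations. Logs base 2, $0\log0=0$.
   Formalization: The edge weights $w$ take values in the positive rationals. -}

module Defs where

open import Data.Bool using (Bool; true; false; if_then_else_)
open import Data.Nat using (ℕ; zero; suc; _*_; _^_; _≤_)
open import Data.Fin using (Fin)
open import Data.Fin.Properties using (_≟_; all?)
open import Data.Maybe using (Maybe; just; nothing; _>>=_)
import Data.Maybe.Properties as MaybeP
open import Data.Product using (_×_; _,_; proj₁; proj₂; ∃-syntax)
open import Data.Sum using (_⊎_)
open import Data.Empty using (⊥)
open import Data.List using (List; []; _∷_; [_]; map; _++_; filter; foldl; length; concatMap; upTo; allFin)
open import Data.Nat.ListAction using (product)
open import Data.List.Relation.Unary.All using (All)
open import Data.List.Relation.Unary.Any using (Any; any?)
open import Data.List.Relation.Unary.AllPairs using (AllPairs; allPairs?)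
open import Data.List.Relation.Binary.Permutation.Propositional using (_↭_)
open import Data.Vec using (Vec; lookup)
import Data.Vec as Vec
open import Data.Rational as ℚ using (ℚ; Positive; 0ℚ; _+_; _⊓_)
open import Relation.Nullary using (¬_; Dec; yes; no; ¬?)
open import Relation.Nullary.Decidable using (⌊_⌋; _×-dec_; _⊎-dec_)
open import Relation.Binary.PropositionalEquality using (_≡_; _≢_)

private
  variable
    n : ℕ

-- If 'directed' is false the
-- edge uv is undirected and may be traversed in both directions with
-- the same weight.

record Graph (n : ℕ) : Set where
  field
    directed : Bool
    edges    : List (Fin n × Fin n × ℚ)
open Graph public

weight : {n : ℕ} → Fin n × Fin n × ℚ → ℚ
weight e = proj₂ (proj₂ e)

PositiveWeights : Graph n → Set
PositiveWeights G = All (λ e → Positive (weight e)) (edges G)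

flipEdge : Fin n × Fin n × ℚ → Fin n × Fin n × ℚ
flipEdge (u , v , w) = (v , u , w)

arcs : Graph n → List (Fin n × Fin n × ℚ)
arcs G = if directed G then edges G else edges G ++ map flipEdge (edges G)

Arc : Graph n → Fin n → Fin n → Set
Arc G u v = Any (λ e → (proj₁ e ≡ u) × (proj₁ (proj₂ e) ≡ v)) (arcs G)

data Reachable {n : ℕ} (G : Graph n) (s : Fin n) : Fin n → Set where
  here : Reachable G s s
  step : ∀ {u v} → Reachable G s u → Arc G u v → Reachable G s v

outArcs : Graph n → Fin n → List (Fin n × ℚ)
outArcs G u = map proj₂ (filter (λ e → proj₁ e ≟ u) (arcs G))

-- Dijkstra's algorithm (the version of the paper), as a
-- nondeterministic small-step semantics: any tie-breaking in
-- ExtractMin and any order of scanning the edges of u is allowed.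

record State (n : ℕ) : Set where
  field
    inserted  : Fin n → Bool
    extracted : Fin n → Bool
    D         : Fin n → Maybe ℚ      -- key / tentative distance; nothing = +∞
    time      : ℕ                    -- number of Insert and ExtractMin operations so far
    insTime   : Fin n → ℕ
    extTime   : Fin n → ℕ
    parent    : Fin n → Maybe (Fin n) -- parent in the exploration tree
open State public

upd : {A : Set} → (Fin n → A) → Fin n → A → Fin n → A
upd f i x j = if ⌊ j ≟ i ⌋ then x else f j

minKey : Maybe ℚ → ℚ → Maybe ℚ
minKey nothing  q = just q
minKey (just p) q = just (p ⊓ q)

initState : Fin n → State n
initState s = record
  { inserted  = upd (λ _ → false) s true
  ; extracted = λ _ → false
  ; D         = upd (λ _ → nothing) s (just 0ℚ)
  ; time      = 1
  ; insTime   = upd (λ _ → 0) s 1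
  ; extTime   = λ _ → 0
  ; parent    = λ _ → nothing
  }

insertV : State n → Fin n → Fin n → State n
insertV st u v = record st
  { inserted = upd (inserted st) v true
  ; D        = upd (D st) v nothing
  ; time     = suc (time st)
  ; insTime  = upd (insTime st) v (suc (time st))
  ; parent   = upd (parent st) v (just u)
  }

relax : Fin n → ℚ → State n → Fin n × ℚ → State n
relax u du st (v , w) =
  if extracted st v then st
  else (let st′ = if inserted st v then st else insertV st u v
        in record st′ { D = upd (D st′) v (minKey (D st′ v) (du + w)) })

processEdges : Fin n → ℚ → State n → List (Fin n × ℚ) → State n
processEdges u du st es = foldl (relax u du) st es

extractV : State n → Fin n → State n
extractV st u = record st
  { extracted = upd (extracted st) u true
  ; time      = suc (time st)
  ; extTime   = upd (extTime st) u (suc (time st))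
  }

InQueue : State n → Fin n → Set
InQueue st v = (inserted st v ≡ true) × (extracted st v ≡ false)

data Run {n : ℕ} (G : Graph n) (s : Fin n) : State n → Set where
  start   : Run G s (initState s)
  extract : ∀ {st} (u : Fin n) (du : ℚ) (order : List (Fin n × ℚ)) →
            Run G s st →
            InQueue st u → D st u ≡ just du →
            (∀ v dv → InQueue st v → D st v ≡ just dv → du ℚ.≤ dv) →
            order ↭ outArcs G u →
            Run G s (processEdges u du (extractV st u) order)

Finished : State n → Set
Finished st = ∀ v → ¬ InQueue st v

iterParent : (Fin n → Maybe (Fin n)) → ℕ → Fin n → Maybe (Fin n)
iterParent p zero    v = just v
iterParent p (suc k) v = iterParent p k v >>= p

-- u is a (proper) ancestor of v.  In a tree on n vertices every ancestor
-- is reached in at most n - 1 parent steps, hence the bounded search.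
Ancestor : (Fin n → Maybe (Fin n)) → Fin n → Fin n → Set
Ancestor {n} p u v = Any (λ k → iterParent p (suc k) v ≡ just u) (upTo n)

ancestor? : (p : Fin n → Maybe (Fin n)) → (u v : Fin n) → Dec (Ancestor p u v)
ancestor? p u v = any? (λ k → MaybeP.≡-dec _≟_ (iterParent p (suc k) v) (just u)) _

IsLinearization : (Fin n → Maybe (Fin n)) → List (Fin n) → Set
IsLinearization p o = AllPairs (λ x y → ¬ Ancestor p y x) o

isLinearization? : (p : Fin n → Maybe (Fin n)) → (o : List (Fin n)) → Dec (IsLinearization p o)
isLinearization? p = allPairs? (λ x y → ¬? (ancestor? p y x))

insertions : {A : Set} → A → List A → List (List A)
insertions x []       = [ x ∷ [] ]
insertions x (y ∷ ys) = (x ∷ y ∷ ys) ∷ map (y ∷_) (insertions x ys)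

perms : {A : Set} → List A → List (List A)
perms []       = [ [] ]
perms (x ∷ xs) = concatMap (insertions x) (perms xs)

linearOrders : (n : ℕ) → List (List (Fin n))
linearOrders n = perms (allFin n)

LinTree : (Fin n → Maybe (Fin n)) → ℕ
LinTree p = length (filter (isLinearization? p) (linearOrders _))

ArcFrom : Graph n → Maybe (Fin n) → Fin n → Set
ArcFrom G nothing  v = ⊥
ArcFrom G (just u) v = Arc G u v

IsSpanningTree : Graph n → Fin n → (Fin n → Maybe (Fin n)) → Set
IsSpanningTree {n} G s p =
  (p s ≡ nothing) ×
  (∀ v → (v ≡ s) ⊎ ArcFrom G (p v) v) ×
  (∀ v → Any (λ k → iterParent p k v ≡ just s) (upTo n))

arcFrom? : (G : Graph n) → (m : Maybe (Fin n)) → (v : Fin n) → Dec (ArcFrom G m v)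
arcFrom? G nothing  v = no (λ ())
arcFrom? G (just u) v = any? (λ e → (proj₁ e ≟ u) ×-dec (proj₁ (proj₂ e) ≟ v)) (arcs G)

isSpanningTree? : (G : Graph n) → (s : Fin n) → (p : Fin n → Maybe (Fin n)) → Dec (IsSpanningTree G s p)
isSpanningTree? G s p =
  MaybeP.≡-dec _≟_ (p s) nothing
  ×-dec all? (λ v → (v ≟ s) ⊎-dec arcFrom? G (p v) v)
  ×-dec all? (λ v → any? (λ k → MaybeP.≡-dec _≟_ (iterParent p k v) (just s)) _)

allVecs : {A : Set} → List A → (m : ℕ) → List (Vec A m)
allVecs xs zero    = [ Vec.[] ]
allVecs xs (suc m) = concatMap (λ x → map (x Vec.∷_) (allVecs xs m)) xs

allParentVecs : (n : ℕ) → List (Vec (Maybe (Fin n)) n)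
allParentVecs n = allVecs (nothing ∷ map just (allFin n)) n

IsLinearizationOfGraph : Graph n → Fin n → List (Fin n) → Set
IsLinearizationOfGraph {n} G s o =
  Any (λ t → IsSpanningTree G s (lookup t) × IsLinearization (lookup t) o) (allParentVecs n)

isLinearizationOfGraph? : (G : Graph n) → (s : Fin n) → (o : List (Fin n)) → Dec (IsLinearizationOfGraph G s o)
isLinearizationOfGraph? {n} G s o =
  any? (λ t → isSpanningTree? G s (lookup t) ×-dec isLinearization? (lookup t) o) (allParentVecs n)

LinGraph : Graph n → Fin n → ℕ
LinGraph {n} G s = length (filter (isLinearizationOfGraph? G s) (linearOrders n))

-- C : Fin n → Fin k colors the interval of each vertex v;
-- each color class has a common point (intervals have integer endpoints)
IsIntersectingColoring : (ℓ r : Fin n → ℕ) → {k : ℕ} → (Fin n → Fin k) → Set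
IsIntersectingColoring ℓ r C = ∀ i → ∃[ t ] (∀ v → C v ≡ i → (ℓ v ≤ t) × (t ≤ r v))

colorCount : {k : ℕ} → (Fin n → Fin k) → Fin k → ℕ
colorCount C i = length (filter (λ v → C v ≟ i) (allFin _))

-- 2 ^ 𝓔(C) = ∏ᵢ cᵢ ^ (2 cᵢ)   (exact, since 𝓔(C) = 2 Σᵢ cᵢ log₂ cᵢ)
twoPowEnergy : {k : ℕ} → (Fin n → Fin k) → ℕ
twoPowEnergy {k = k} C = product (map (λ i → colorCount C i ^ (2 * colorCount C i)) (allFin k))

-- A vertex is inserted only while its parent in the exploration tree is being processed, so a
-- proper ancestor u of v is extracted before v is inserted: r(u) < ℓ(v).  Neither the weights nor
-- the keys enter this argument.  Pick a common point t_i of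
-- each colour class i.  For an ancestor u of v, t_{C u} ≤ r(u) < ℓ(v) ≤ t_{C v}, hence every
-- order of the vertices sorted by the key (t_{C v}, C v) is a linearization of the tree.  Sorted
-- orders may permute each colour class freely, so Lin(T) ≥ ∏ c_i!, and c^(2c) ≤ (c!)^4 (from
-- c^c ≤ (c!)^2) gives 2^𝓔(C) ≤ Lin(T)^4.  Parent chains decrease the extraction time, so the
-- exploration tree is a spanning tree and Lin(T) ≤ Lin(G).

module Submission where

open import Defs
open import Data.Nat using (ℕ; _≤_; _^_)
open import Data.Fin using (Fin)
open import Data.Product using (_×_; ∃-syntax)

open import Data.Bool using (true; false)
open import Data.Fin using (zero; suc; toℕ)
open import Data.Fin.Properties using (toℕ<n; toℕ-injective; suc-injective) renaming (_≟_ to _≟ᶠ_)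
open import Data.List using (List; []; _∷_; _++_; map; filter; length; concatMap; tabulate; allFin; upTo)
open import Data.List.Membership.Propositional using (_∈_; find; lose)
open import Data.List.Membership.Propositional.Properties
  using (∈-allFin; ∈-upTo⁺; ∈-map⁺; ∈-concatMap⁺; ∈-map∘filter⁺; ∈-map∘filter⁻)
import Data.List.Properties as Listₚ
open import Data.List.Relation.Binary.Permutation.Propositional as ↭ using (_↭_; prep; swap; ↭-sym)
open import Data.List.Relation.Binary.Permutation.Propositional.Properties
  using (↭-length; filter-↭; All-resp-↭; ∈-resp-↭)
open import Data.List.Relation.Binary.Sublist.Propositional using (⊆-refl)
open import Data.List.Relation.Binary.Sublist.Propositional.Properties using (length-mono-≤; filter⁺)
open import Data.List.Relation.Unary.All as All using (All; []; _∷_)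
import Data.List.Relation.Unary.All.Properties as Allₚ
open import Data.List.Relation.Unary.AllPairs as AllPairs using (AllPairs; []; _∷_)
open import Data.List.Relation.Unary.Any as Any using (Any; here; there)
open import Data.Maybe using (Maybe; just; nothing; _>>=_)
open import Data.Nat using (zero; suc; _+_; _*_; _<_; z≤n; s≤s; _≤?_; _<?_; _!)
open import Data.Nat.Induction using (<-wellFounded)
open import Data.Nat.ListAction using (product)
import Data.Nat.Properties as ℕₚ
open import Data.Nat.Solver using (module +-*-Solver)
open import Data.Product using (_,_; proj₁; proj₂)
open import Data.Rational using (ℚ)
open import Data.Sum as Sum using (_⊎_; inj₁; inj₂)
open import Data.Vec as Vec using (Vec; lookup)
open import Data.Vec.Properties using (lookup∘tabulate)
open import Function using (_∘_)
open import Induction.WellFounded using (Acc; acc)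
open import Level using (Level)
open import Relation.Binary.Definitions using (tri<; tri≈; tri>)
open import Relation.Binary.PropositionalEquality
open import Relation.Nullary using (¬_; Dec; yes; no; contradiction)
open import Relation.Unary using (Pred; Decidable)

open +-*-Solver using (solve; _:*_; _:^_; _:=_)

module _ {a p q : Level} {A : Set a} {P : Pred A p} {Q : Pred A q} (P? : Decidable P) (Q? : Decidable Q)
         (P⇒Q : ∀ {x} → P x → Q x) where

  length-filter-mono-≤ : ∀ xs → length (filter P? xs) ≤ length (filter Q? xs)
  length-filter-mono-≤ xs = length-mono-≤ (filter⁺ P? Q? (λ { refl → P⇒Q }) (⊆-refl {x = xs}))

  length-filter-mono-< : ∀ {xs} → Any (λ x → Q x × ¬ P x) xs → length (filter P? xs) < length (filter Q? xs)
  length-filter-mono-< {x ∷ xs} witness with P? x | Q? x | witness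
  ... | yes px | no ¬qx | _                  = contradiction (P⇒Q px) ¬qx
  ... | yes px | _      | here (_ , ¬px)     = contradiction px ¬px
  ... | no _   | no ¬qx | here (qx , _)      = contradiction qx ¬qx
  ... | no _   | yes _  | here _             = s≤s (length-filter-mono-≤ xs)
  ... | yes _  | yes _  | there witness′     = s≤s (length-filter-mono-< witness′)
  ... | no _   | yes _  | there witness′     = ℕₚ.m≤n⇒m≤1+n (length-filter-mono-< witness′)
  ... | no _   | no _   | there witness′     = length-filter-mono-< witness′

-- Products and factorials

∏ : ∀ {k} → (Fin k → ℕ) → ℕ
∏ f = product (tabulate f)

∏-mono-≤ : ∀ {k} {f g : Fin k → ℕ} → (∀ i → f i ≤ g i) → ∏ f ≤ ∏ g
∏-mono-≤ {zero}  f≤g = ℕₚ.≤-refl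
∏-mono-≤ {suc k} f≤g = ℕₚ.*-mono-≤ (f≤g zero) (∏-mono-≤ (f≤g ∘ suc))

^-distribʳ-* : ∀ a b m → (a * b) ^ m ≡ a ^ m * b ^ m
^-distribʳ-* a b zero    = refl
^-distribʳ-* a b (suc m) = trans (cong (a * b *_) (^-distribʳ-* a b m)) (ℕₚ.[m*n]*[o*p]≡[m*o]*[n*p] a b _ _)

∏-^ : ∀ {k} (f : Fin k → ℕ) m → ∏ (λ i → f i ^ m) ≡ ∏ f ^ m
∏-^ {zero}  f m = sym (ℕₚ.^-zeroˡ m)
∏-^ {suc k} f m = trans (cong (f zero ^ m *_) (∏-^ (f ∘ suc) m)) (sym (^-distribʳ-* (f zero) _ m))

∏-1 : ∀ {k} → ∏ {k} (λ _ → 1) ≡ 1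
∏-1 {zero}  = refl
∏-1 {suc k} = trans (ℕₚ.+-identityʳ _) (∏-1 {k})

∏-update : ∀ {k} (f g : Fin k → ℕ) j a → (∀ i → i ≢ j → g i ≡ f i) → g j ≡ f j * a → ∏ g ≡ ∏ f * a
∏-update {suc k} f g zero a others changed = begin
  g zero * ∏ (g ∘ suc)     ≡⟨ cong₂ _*_ changed (cong product (Listₚ.tabulate-cong λ i → others (suc i) λ ())) ⟩
  f zero * a * ∏ (f ∘ suc) ≡⟨ rearrange a (f zero) (∏ (f ∘ suc)) ⟩
  f zero * ∏ (f ∘ suc) * a ∎
  where
  open ≡-Reasoning
  rearrange : ∀ a x y → x * a * y ≡ x * y * a
  rearrange = solve 3 (λ a x y → x :* a :* y := x :* y :* a) refl
∏-update {suc k} f g (suc j) a others changed = begin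
  g zero * ∏ (g ∘ suc)     ≡⟨ cong₂ _*_ (others zero λ ()) (∏-update (f ∘ suc) (g ∘ suc) j a others′ changed) ⟩
  f zero * (∏ (f ∘ suc) * a) ≡⟨ sym (ℕₚ.*-assoc (f zero) _ a) ⟩
  f zero * ∏ (f ∘ suc) * a ∎
  where
  open ≡-Reasoning
  others′ : ∀ i → i ≢ j → g (suc i) ≡ f (suc i)
  others′ i i≢j = others (suc i) (i≢j ∘ suc-injective)

-- Generalises c ^ c ≤ c ! * c ! (the case a = 0) so that the induction on j goes through.
[j+a]^j*a!≤[j+a]!*j! : ∀ j a → (j + a) ^ j * a ! ≤ (j + a) ! * j !
[j+a]^j*a!≤[j+a]!*j! zero    a = ℕₚ.≤-reflexive (trans (ℕₚ.+-identityʳ (a !)) (sym (ℕₚ.*-identityʳ (a !))))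
[j+a]^j*a!≤[j+a]!*j! (suc j) a = begin
  c * c ^ j * a !               ≤⟨ ℕₚ.*-monoˡ-≤ (a !) (ℕₚ.*-monoˡ-≤ (c ^ j) c≤) ⟩
  suc j * suc a * c ^ j * a !   ≡⟨ rearrange (suc j) (suc a) (c ^ j) (a !) ⟩
  suc j * (c ^ j * suc a !)     ≤⟨ ℕₚ.*-monoʳ-≤ (suc j) induction ⟩
  suc j * (c ! * j !)           ≡⟨ ℕₚ.*-comm (suc j) _ ⟩
  c ! * j ! * suc j             ≡⟨ ℕₚ.*-assoc (c !) _ _ ⟩
  c ! * (j ! * suc j)           ≡⟨ cong (c ! *_) (ℕₚ.*-comm (j !) (suc j)) ⟩
  c ! * suc j !                 ∎
  where
  open ℕₚ.≤-Reasoning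
  c : ℕ
  c = suc (j + a)
  c≤ : c ≤ suc j * suc a
  c≤ = s≤s (begin
    j + a           ≡⟨ ℕₚ.+-comm j a ⟩
    a + j           ≤⟨ ℕₚ.+-monoʳ-≤ a (ℕₚ.m≤m*n j (suc a)) ⟩
    a + j * suc a   ∎)
  induction : c ^ j * suc a ! ≤ c ! * j !
  induction = subst (λ m → m ^ j * suc a ! ≤ m ! * j !) (ℕₚ.+-suc j a) ([j+a]^j*a!≤[j+a]!*j! j (suc a))
  rearrange : ∀ x y z w → x * y * z * w ≡ x * (z * (y * w))
  rearrange = solve 4 (λ x y z w → x :* y :* z :* w := x :* (z :* (y :* w))) refl

c^c≤c!*c! : ∀ c → c ^ c ≤ c ! * c !
c^c≤c!*c! c = subst (_≤ c ! * c !) (ℕₚ.*-identityʳ (c ^ c))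
                   (subst (λ m → m ^ c * 1 ≤ m ! * c !) (ℕₚ.+-identityʳ c) ([j+a]^j*a!≤[j+a]!*j! c 0))

c^[2c]≤[c!]^4 : ∀ c → c ^ (2 * c) ≤ (c !) ^ 4
c^[2c]≤[c!]^4 c = begin
  c ^ (2 * c)       ≡⟨ cong (c ^_) (ℕₚ.*-comm 2 c) ⟩
  c ^ (c * 2)       ≡⟨ ℕₚ.^-*-assoc c c 2 ⟨
  (c ^ c) ^ 2       ≤⟨ ℕₚ.^-monoˡ-≤ 2 (c^c≤c!*c! c) ⟩
  (c ! * c !) ^ 2   ≡⟨ square-square (c !) ⟩
  (c !) ^ 4         ∎
  where
  open ℕₚ.≤-Reasoning
  square-square : ∀ x → (x * x) ^ 2 ≡ x ^ 4
  square-square = solve 1 (λ x → (x :* x) :^ 2 := x :^ 4) refl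

-- Counting sorted permutations

insertions-↭ : ∀ {A : Set} (x : A) ys → All (_↭ x ∷ ys) (insertions x ys)
insertions-↭ x []       = ↭.refl ∷ []
insertions-↭ x (y ∷ ys) =
  ↭.refl ∷ Allₚ.map⁺ (All.map (λ o↭ → ↭.trans (prep y o↭) (swap y x ↭.refl)) (insertions-↭ x ys))

perms-↭ : ∀ {A : Set} (xs : List A) → All (_↭ xs) (perms xs)
perms-↭ []       = ↭.refl ∷ []
perms-↭ (x ∷ xs) = Allₚ.concat⁺ (Allₚ.map⁺ (All.map insertions-↭-perm (perms-↭ xs)))
  where
  insertions-↭-perm : ∀ {o} → o ↭ xs → All (_↭ x ∷ xs) (insertions x o)
  insertions-↭-perm o↭ = All.map (λ p↭ → ↭.trans p↭ (prep x o↭)) (insertions-↭ x _)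

module SortedPermutations {A : Set} {k : ℕ} (C : A → Fin k) (r : Fin k → ℕ)
                          (r-injective : ∀ {i j} → r i ≡ r j → i ≡ j) where

  open ℕₚ.≤-Reasoning

  key : A → ℕ
  key = r ∘ C

  Sorted : List A → Set
  Sorted = AllPairs (λ x y → key x ≤ key y)

  sorted? : Decidable Sorted
  sorted? = AllPairs.allPairs? (λ x y → key x ≤? key y)

  count : List A → Fin k → ℕ
  count xs i = length (filter (λ x → C x ≟ᶠ i) xs)

  #sorted : List (List A) → ℕ
  #sorted L = length (filter sorted? L)

  count-↭ : ∀ {xs ys} i → xs ↭ ys → count xs i ≡ count ys i
  count-↭ i xs↭ys = ↭-length (filter-↭ (λ x → C x ≟ᶠ i) xs↭ys)

  count-∷-same : ∀ {y} ys i → C y ≡ i → count (y ∷ ys) i ≡ suc (count ys i)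
  count-∷-same ys i Cy≡i = cong length (Listₚ.filter-accept (λ x → C x ≟ᶠ i) Cy≡i)

  count-∷-other : ∀ {y} ys i → C y ≢ i → count (y ∷ ys) i ≡ count ys i
  count-∷-other ys i Cy≢i = cong length (Listₚ.filter-reject (λ x → C x ≟ᶠ i) Cy≢i)

  #sorted-++ : ∀ L M → #sorted (L ++ M) ≡ #sorted L + #sorted M
  #sorted-++ L M = trans (cong length (Listₚ.filter-++ sorted? L M)) (Listₚ.length-++ (filter sorted? L))

  #sorted-∷-sorted : ∀ o L → Sorted o → #sorted (o ∷ L) ≡ suc (#sorted L)
  #sorted-∷-sorted o L so = cong length (Listₚ.filter-accept sorted? so)

  #sorted-∷ : ∀ o L → #sorted L ≤ #sorted (o ∷ L)
  #sorted-∷ o L with sorted? o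
  ... | yes _ = ℕₚ.n≤1+n _
  ... | no _  = ℕₚ.≤-refl

  #sorted-map-∷ : ∀ y L → All (All (λ z → key y ≤ key z)) L → #sorted L ≤ #sorted (map (y ∷_) L)
  #sorted-map-∷ y []      []          = z≤n
  #sorted-map-∷ y (o ∷ L) (y≤o ∷ y≤L) = by-cases (sorted? o)
    where
    induction : #sorted L ≤ #sorted (map (y ∷_) L)
    induction = #sorted-map-∷ y L y≤L
    by-cases : Dec (Sorted o) → #sorted (o ∷ L) ≤ #sorted ((y ∷ o) ∷ map (y ∷_) L)
    by-cases (yes so) = begin
      #sorted (o ∷ L)                    ≡⟨ #sorted-∷-sorted o L so ⟩
      suc (#sorted L)                    ≤⟨ s≤s induction ⟩
      suc (#sorted (map (y ∷_) L))       ≡⟨ #sorted-∷-sorted (y ∷ o) (map (y ∷_) L) (y≤o ∷ so) ⟨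
      #sorted ((y ∷ o) ∷ map (y ∷_) L)   ∎
    by-cases (no ¬so) = begin
      #sorted (o ∷ L)                    ≡⟨ cong length (Listₚ.filter-reject sorted? ¬so) ⟩
      #sorted L                          ≤⟨ induction ⟩
      #sorted (map (y ∷_) L)             ≤⟨ #sorted-∷ (y ∷ o) (map (y ∷_) L) ⟩
      #sorted ((y ∷ o) ∷ map (y ∷_) L)   ∎

  count-above : ∀ {x} ys → All (λ z → key x < key z) ys → count ys (C x) ≡ 0
  count-above ys x<ys = cong length (Listₚ.filter-none (λ z → C z ≟ᶠ _) (All.map different x<ys))
    where
    different : ∀ {x z} → key x < key z → C z ≢ C x
    different x<z Cz≡Cx = ℕₚ.<-irrefl (cong r (sym Cz≡Cx)) x<z

  ∷-sorted : ∀ {x y ys} → key x ≤ key y → Sorted (y ∷ ys) → Sorted (x ∷ y ∷ ys)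
  ∷-sorted x≤y sorted@(y≤ys ∷ _) = (x≤y ∷ All.map (ℕₚ.≤-trans x≤y) y≤ys) ∷ sorted

  #sorted-insertions-front : ∀ {x y ys} → key x ≤ key y → Sorted (y ∷ ys) →
                             #sorted (insertions x (y ∷ ys)) ≡ suc (#sorted (map (y ∷_) (insertions x ys)))
  #sorted-insertions-front {x} {y} {ys} x≤y sorted = #sorted-∷-sorted _ (map (y ∷_) (insertions x ys)) (∷-sorted x≤y sorted)

  #sorted-insertions-behind : ∀ {x y ys} → key y ≤ key x → All (λ z → key y ≤ key z) ys →
                              #sorted (insertions x ys) ≤ #sorted (map (y ∷_) (insertions x ys))
  #sorted-insertions-behind {x} {y} {ys} y≤x y≤ys =
    #sorted-map-∷ y (insertions x ys) (All.map (λ o↭ → All-resp-↭ (↭-sym o↭) (y≤x ∷ y≤ys)) (insertions-↭ x ys))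

  -- x may be placed anywhere within the block of entries whose key equals key x.
  #sorted-insertions : ∀ x {o} → Sorted o → suc (count o (C x)) ≤ #sorted (insertions x o)
  #sorted-insertions x {[]}     []                            = s≤s z≤n
  #sorted-insertions x {y ∷ ys} sorted@(y≤ys ∷ sorted-ys) with ℕₚ.<-cmp (key x) (key y)
  ... | tri< x<y _ _ = begin
    suc (count (y ∷ ys) (C x))                   ≡⟨ cong suc (count-above (y ∷ ys) (x<y ∷ All.map (ℕₚ.<-≤-trans x<y) y≤ys)) ⟩
    1                                            ≤⟨ s≤s z≤n ⟩
    suc (#sorted (map (y ∷_) (insertions x ys))) ≡⟨ #sorted-insertions-front (ℕₚ.<⇒≤ x<y) sorted ⟨
    #sorted (insertions x (y ∷ ys))              ∎
  ... | tri≈ _ x≡y _ = begin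
    suc (count (y ∷ ys) (C x))                   ≡⟨ cong suc (count-∷-same ys (C x) (r-injective (sym x≡y))) ⟩
    suc (suc (count ys (C x)))                   ≤⟨ s≤s (#sorted-insertions x sorted-ys) ⟩
    suc (#sorted (insertions x ys))              ≤⟨ s≤s (#sorted-insertions-behind (ℕₚ.≤-reflexive (sym x≡y)) y≤ys) ⟩
    suc (#sorted (map (y ∷_) (insertions x ys))) ≡⟨ #sorted-insertions-front (ℕₚ.≤-reflexive x≡y) sorted ⟨
    #sorted (insertions x (y ∷ ys))              ∎
  ... | tri> _ _ y<x = begin
    suc (count (y ∷ ys) (C x))                   ≡⟨ cong suc (count-∷-other ys (C x) (ℕₚ.<⇒≢ y<x ∘ cong r)) ⟩
    suc (count ys (C x))                         ≤⟨ #sorted-insertions x sorted-ys ⟩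
    #sorted (insertions x ys)                    ≤⟨ #sorted-insertions-behind (ℕₚ.<⇒≤ y<x) y≤ys ⟩
    #sorted (map (y ∷_) (insertions x ys))       ≤⟨ #sorted-∷ (x ∷ y ∷ ys) _ ⟩
    #sorted (insertions x (y ∷ ys))              ∎

  #sorted-concatMap-insertions : ∀ x m L → All (λ o → count o (C x) ≡ m) L →
                                 #sorted L * suc m ≤ #sorted (concatMap (insertions x) L)
  #sorted-concatMap-insertions x m []      []             = z≤n
  #sorted-concatMap-insertions x m (o ∷ L) (o≡m ∷ L≡m) =
    subst (_ ≤_) (sym (#sorted-++ (insertions x o) (concatMap (insertions x) L))) (by-cases (sorted? o))
    where
    induction : #sorted L * suc m ≤ #sorted (concatMap (insertions x) L)
    induction = #sorted-concatMap-insertions x m L L≡m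
    by-cases : Dec (Sorted o) → #sorted (o ∷ L) * suc m ≤ #sorted (insertions x o) + #sorted (concatMap (insertions x) L)
    by-cases (yes so) rewrite #sorted-∷-sorted o L so =
      ℕₚ.+-mono-≤ (subst (λ c → suc c ≤ _) o≡m (#sorted-insertions x so)) induction
    by-cases (no ¬so) rewrite Listₚ.filter-reject sorted? {xs = L} ¬so =
      ℕₚ.≤-trans induction (ℕₚ.m≤n+m _ _)

  ∏-count-!≤#sorted-perms : ∀ xs → ∏ (λ i → count xs i !) ≤ #sorted (perms xs)
  ∏-count-!≤#sorted-perms []       = ℕₚ.≤-reflexive (∏-1 {k})
  ∏-count-!≤#sorted-perms (x ∷ xs) = begin
    ∏ (λ i → count (x ∷ xs) i !)                  ≡⟨ ∏-update (λ i → count xs i !) _ (C x) _ others changed ⟩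
    ∏ (λ i → count xs i !) * suc (count xs (C x)) ≤⟨ ℕₚ.*-monoˡ-≤ _ (∏-count-!≤#sorted-perms xs) ⟩
    #sorted (perms xs) * suc (count xs (C x))     ≤⟨ #sorted-concatMap-insertions x _ (perms xs) perms-count ⟩
    #sorted (perms (x ∷ xs))                      ∎
    where
    others : ∀ i → i ≢ C x → count (x ∷ xs) i ! ≡ count xs i !
    others i i≢Cx = cong _! (count-∷-other xs i (i≢Cx ∘ sym))
    changed : count (x ∷ xs) (C x) ! ≡ count xs (C x) ! * suc (count xs (C x))
    changed = trans (cong _! (count-∷-same xs (C x) refl)) (ℕₚ.*-comm (suc (count xs (C x))) _)
    perms-count : All (λ o → count o (C x) ≡ count xs (C x)) (perms xs)
    perms-count = All.map (count-↭ (C x)) (perms-↭ xs)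

-- Parent functions and linearizations

module _ {n : ℕ} (p : Fin n → Maybe (Fin n)) where

  iterParent-suc : ∀ k v → iterParent p (suc k) v ≡ (p v >>= iterParent p k)
  iterParent-suc zero    v with p v
  ... | nothing = refl
  ... | just _  = refl
  iterParent-suc (suc k) v rewrite iterParent-suc k v with p v
  ... | nothing = refl
  ... | just _  = refl

  ancestor-via-parent : ∀ {u v} → Ancestor p u v → ∃[ w ] (p v ≡ just w × ∃[ k ] iterParent p k w ≡ just u)
  ancestor-via-parent {v = v} ancestor with Any.satisfied ancestor
  ... | k , v↑u with p v | trans (sym (iterParent-suc k v)) v↑u
  ...   | just w | w↑u = w , refl , k , w↑u

module RankedParents {n : ℕ} (p : Fin n → Maybe (Fin n)) (rank : Fin n → ℕ)
                     (rank-parent< : ∀ {u v} → p v ≡ just u → rank u < rank v) where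

  rank-iterParent-≤ : ∀ k {u v} → iterParent p k v ≡ just u → rank u ≤ rank v
  rank-iterParent-≤ zero    refl = ℕₚ.≤-refl
  rank-iterParent-≤ (suc k) {v = v} v↑u with iterParent p k v in v↑w
  ... | just w = ℕₚ.<⇒≤ (ℕₚ.<-≤-trans (rank-parent< v↑u) (rank-iterParent-≤ k v↑w))

  lowerRanked : Fin n → List (Fin n)
  lowerRanked v = filter (λ w → rank w <? rank v) (allFin n)

  lowerRanked-< : ∀ {u v} → rank u < rank v → length (lowerRanked u) < length (lowerRanked v)
  lowerRanked-< {u} {v} u<v = length-filter-mono-< (λ w → rank w <? rank u) (λ w → rank w <? rank v)
    (λ w<u → ℕₚ.<-trans w<u u<v) (lose (∈-allFin u) (u<v , ℕₚ.<-irrefl refl))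

  lowerRanked<n : ∀ v → length (lowerRanked v) < n
  lowerRanked<n v = subst (length (lowerRanked v) <_) (Listₚ.length-tabulate (λ i → i))
    (Listₚ.filter-notAll (λ w → rank w <? rank v) (allFin n) (lose (∈-allFin v) (ℕₚ.<-irrefl refl)))

  module _ {s : Fin n} (root-or-child : ∀ v → v ≡ s ⊎ ∃[ u ] p v ≡ just u) where

    depth≤lowerRanked : ∀ v → Acc _<_ (rank v) → ∃[ k ] (k ≤ length (lowerRanked v) × iterParent p k v ≡ just s)
    depth≤lowerRanked v (acc smaller) with root-or-child v
    ... | inj₁ refl = 0 , z≤n , refl
    ... | inj₂ (u , pv) with depth≤lowerRanked u (smaller (rank-parent< pv))
    ...   | k , k≤ , u↑s = suc k , ℕₚ.≤-trans (s≤s k≤) (lowerRanked-< (rank-parent< pv))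
                         , trans (iterParent-suc p k v) (trans (cong (_>>= iterParent p k) pv) u↑s)

    reaches-root : ∀ v → Any (λ k → iterParent p k v ≡ just s) (upTo n)
    reaches-root v with depth≤lowerRanked v (<-wellFounded (rank v))
    ... | k , k≤ , v↑s = lose (∈-upTo⁺ (ℕₚ.≤-<-trans k≤ (lowerRanked<n v))) v↑s

iterParent-cong : ∀ {n} {p q : Fin n → Maybe (Fin n)} → (∀ v → p v ≡ q v) → ∀ k v → iterParent p k v ≡ iterParent q k v
iterParent-cong         p≗q zero    v = refl
iterParent-cong {q = q} p≗q (suc k) v rewrite iterParent-cong p≗q k v with iterParent q k v
... | nothing = refl
... | just w  = p≗q w

module _ {n : ℕ} {p q : Fin n → Maybe (Fin n)} (p≗q : ∀ v → p v ≡ q v) where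

  IsSpanningTree-cong : ∀ {G s} → IsSpanningTree G s p → IsSpanningTree G s q
  IsSpanningTree-cong {G} {s} (root , arcs , reach) =
      trans (sym (p≗q s)) root
    , (λ v → Sum.map₂ (subst (λ m → ArcFrom G m v) (p≗q v)) (arcs v))
    , (λ v → Any.map (λ {k} v↑s → trans (sym (iterParent-cong p≗q k v)) v↑s) (reach v))

  IsLinearization-cong : ∀ {o} → IsLinearization p o → IsLinearization q o
  IsLinearization-cong = AllPairs.map λ {x} ¬ancestor ancestor →
    ¬ancestor (Any.map (λ {k} x↑y → trans (iterParent-cong p≗q (suc k) x) x↑y) ancestor)

allVecs-complete : ∀ {A : Set} (xs : List A) {m} (v : Vec A m) → (∀ i → lookup v i ∈ xs) → v ∈ allVecs xs m
allVecs-complete xs Vec.[]       _    = here refl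
allVecs-complete xs (a Vec.∷ v) all∈ = ∈-concatMap⁺ (λ x → map (x Vec.∷_) (allVecs xs _)) (Any.map extend (all∈ zero))
  where
  extend : ∀ {x} → a ≡ x → a Vec.∷ v ∈ map (x Vec.∷_) (allVecs xs _)
  extend refl = ∈-map⁺ (a Vec.∷_) (allVecs-complete xs v (all∈ ∘ suc))

tabulate∈allParentVecs : ∀ {n} (p : Fin n → Maybe (Fin n)) → Vec.tabulate p ∈ allParentVecs n
tabulate∈allParentVecs {n} p = allVecs-complete _ (Vec.tabulate p)
  (λ i → subst (_∈ nothing ∷ map just (allFin n)) (sym (lookup∘tabulate p i)) (value∈ (p i)))
  where
  value∈ : ∀ m → m ∈ nothing ∷ map just (allFin n)
  value∈ nothing  = here refl
  value∈ (just i) = there (∈-map⁺ just (∈-allFin i))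

LinTree≤LinGraph : ∀ {n} {G : Graph n} {s} {p} → IsSpanningTree G s p → LinTree p ≤ LinGraph G s
LinTree≤LinGraph {n} {G} {s} {p} spanning =
  length-filter-mono-≤ (isLinearization? p) (isLinearizationOfGraph? G s) linearization-of-graph (linearOrders n)
  where
  p≗lookup : ∀ v → p v ≡ lookup (Vec.tabulate p) v
  p≗lookup v = sym (lookup∘tabulate p v)
  linearization-of-graph : ∀ {o} → IsLinearization p o → IsLinearizationOfGraph G s o
  linearization-of-graph linear =
    lose (tabulate∈allParentVecs p) (IsSpanningTree-cong p≗lookup spanning , IsLinearization-cong p≗lookup linear)

module _ {k : ℕ} (t : Fin k → ℕ) where

  lexRank : Fin k → ℕ
  lexRank i = t i * k + toℕ i

  lexRank-mono-< : ∀ {i j} → t i < t j → lexRank i < lexRank j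
  lexRank-mono-< {i} {j} ti<tj = begin-strict
    t i * k + toℕ i <⟨ ℕₚ.+-monoʳ-< (t i * k) (toℕ<n i) ⟩
    t i * k + k     ≡⟨ ℕₚ.+-comm (t i * k) k ⟩
    suc (t i) * k   ≤⟨ ℕₚ.*-monoˡ-≤ k ti<tj ⟩
    t j * k         ≤⟨ ℕₚ.m≤m+n (t j * k) (toℕ j) ⟩
    lexRank j       ∎
    where open ℕₚ.≤-Reasoning

  lexRank-injective : ∀ {i j} → lexRank i ≡ lexRank j → i ≡ j
  lexRank-injective {i} {j} same with ℕₚ.<-cmp (t i) (t j)
  ... | tri< ti<tj _ _ = contradiction same (ℕₚ.<⇒≢ (lexRank-mono-< ti<tj))
  ... | tri> _ _ tj<ti = contradiction (sym same) (ℕₚ.<⇒≢ (lexRank-mono-< tj<ti))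
  ... | tri≈ _ ti≡tj _ =
    toℕ-injective (ℕₚ.+-cancelˡ-≡ (t j * k) _ _ (trans (cong (λ m → m * k + toℕ i) (sym ti≡tj)) same))

twoPowEnergy≤∏-colorCount-!^4 : ∀ {n k} (C : Fin n → Fin k) → twoPowEnergy C ≤ ∏ (λ i → colorCount C i !) ^ 4
twoPowEnergy≤∏-colorCount-!^4 {k = k} C = begin
  twoPowEnergy C                          ≡⟨ cong product (Listₚ.map-tabulate (λ i → i) (λ i → c i ^ (2 * c i))) ⟩
  ∏ (λ i → c i ^ (2 * c i))               ≤⟨ ∏-mono-≤ (λ i → c^[2c]≤[c!]^4 (c i)) ⟩
  ∏ (λ i → (c i !) ^ 4)                   ≡⟨ ∏-^ (λ i → c i !) 4 ⟩
  ∏ (λ i → c i !) ^ 4                     ∎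
  where
  open ℕₚ.≤-Reasoning
  c : Fin k → ℕ
  c = colorCount C

∏-colorCount-!≤LinTree : ∀ {n k} (p : Fin n → Maybe (Fin n)) (ℓ r : Fin n → ℕ) (C : Fin n → Fin k) →
                         (∀ {u v} → Ancestor p u v → r u < ℓ v) → IsIntersectingColoring ℓ r C →
                         ∏ (λ i → colorCount C i !) ≤ LinTree p
∏-colorCount-!≤LinTree {n} {k} p ℓ r C ancestor-before coloring = begin
  ∏ (λ i → colorCount C i !) ≤⟨ ∏-count-!≤#sorted-perms (allFin n) ⟩
  #sorted (linearOrders n)   ≤⟨ length-filter-mono-≤ sorted? (isLinearization? p) sorted⇒linearization (linearOrders n) ⟩
  LinTree p                  ∎
  where
  open ℕₚ.≤-Reasoning
  point : Fin k → ℕ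
  point i = proj₁ (coloring i)
  open SortedPermutations C (lexRank point) (lexRank-injective point)
  ancestor-key< : ∀ {u v} → Ancestor p u v → key u < key v
  ancestor-key< {u} {v} ancestor = lexRank-mono-< point (begin-strict
    point (C u) ≤⟨ proj₂ (proj₂ (coloring (C u)) u refl) ⟩
    r u         <⟨ ancestor-before ancestor ⟩
    ℓ v         ≤⟨ proj₁ (proj₂ (coloring (C v)) v refl) ⟩
    point (C v) ∎)
  sorted⇒linearization : ∀ {o} → Sorted o → IsLinearization p o
  sorted⇒linearization = AllPairs.map λ x≤y y-ancestor-of-x → ℕₚ.<⇒≱ (ancestor-key< y-ancestor-of-x) x≤y

-- Runs of Dijkstra's algorithm

module _ {n : ℕ} {A : Set} (f : Fin n → A) (i : Fin n) (x : A) where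

  upd-same : upd f i x i ≡ x
  upd-same with i ≟ᶠ i
  ... | yes _   = refl
  ... | no i≢i = contradiction refl i≢i

  upd-other : ∀ {j} → j ≢ i → upd f i x j ≡ f j
  upd-other {j} j≢i with j ≟ᶠ i
  ... | yes j≡i = contradiction j≡i j≢i
  ... | no _    = refl

module DijkstraInvariant {n : ℕ} (G : Graph n) (s : Fin n) where

  record Invariant (st : State n) : Set where
    field
      root-inserted          : inserted st s ≡ true
      root-parentless        : parent st s ≡ nothing
      extracted⇒inserted     : ∀ {v} → extracted st v ≡ true → inserted st v ≡ true
      inserted⇒root-or-child : ∀ {v} → inserted st v ≡ true → v ≡ s ⊎ ∃[ u ] parent st v ≡ just u
      parent-arc             : ∀ {u v} → parent st v ≡ just u → Arc G u v
      parent-extracted       : ∀ {u v} → parent st v ≡ just u → extracted st u ≡ true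
      insTime≤time           : ∀ {v} → inserted st v ≡ true → insTime st v ≤ time st
      extTime≤time           : ∀ {v} → extracted st v ≡ true → extTime st v ≤ time st
      insTime<extTime        : ∀ {v} → extracted st v ≡ true → insTime st v < extTime st v
      parent-extTime<insTime : ∀ {u v} → parent st v ≡ just u → extTime st u < insTime st v
  open Invariant

  invariant-init : Invariant (initState s)
  invariant-init = record
    { root-inserted          = upd-same _ s true
    ; root-parentless        = refl
    ; extracted⇒inserted     = λ ()
    ; inserted⇒root-or-child = only-root
    ; parent-arc             = λ ()
    ; parent-extracted       = λ ()
    ; insTime≤time           = λ {v} _ → ins≤1 v
    ; extTime≤time           = λ ()
    ; insTime<extTime        = λ ()
    ; parent-extTime<insTime = λ ()
    }
    where
    only-root : ∀ {v} → inserted (initState s) v ≡ true → v ≡ s ⊎ ∃[ u ] parent (initState s) v ≡ just u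
    only-root {v} inserted-v with v ≟ᶠ s
    ... | yes v≡s = inj₁ v≡s
    ins≤1 : ∀ v → insTime (initState s) v ≤ 1
    ins≤1 v with v ≟ᶠ s
    ... | yes _ = ℕₚ.≤-refl
    ... | no _  = z≤n

  invariant-extract : ∀ {st u} → Invariant st → InQueue st u → Invariant (extractV st u)
  invariant-extract {st} {u} inv (inserted-u , not-extracted-u) = record
    { root-inserted          = root-inserted inv
    ; root-parentless        = root-parentless inv
    ; extracted⇒inserted     = extracted⇒inserted′
    ; inserted⇒root-or-child = inserted⇒root-or-child inv
    ; parent-arc             = parent-arc inv
    ; parent-extracted       = parent-extracted′
    ; insTime≤time           = ℕₚ.m≤n⇒m≤1+n ∘ insTime≤time inv
    ; extTime≤time           = extTime≤time′
    ; insTime<extTime        = insTime<extTime′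
    ; parent-extTime<insTime = parent-extTime<insTime′
    }
    where
    st′ : State n
    st′ = extractV st u
    extracted⇒inserted′ : ∀ {v} → extracted st′ v ≡ true → inserted st v ≡ true
    extracted⇒inserted′ {v} extracted-v with v ≟ᶠ u
    ... | yes refl = inserted-u
    ... | no _     = extracted⇒inserted inv extracted-v
    parent-extracted′ : ∀ {w v} → parent st v ≡ just w → extracted st′ w ≡ true
    parent-extracted′ {w} pv with w ≟ᶠ u
    ... | yes _ = refl
    ... | no _  = parent-extracted inv pv
    extTime≤time′ : ∀ {v} → extracted st′ v ≡ true → extTime st′ v ≤ time st′
    extTime≤time′ {v} extracted-v with v ≟ᶠ u
    ... | yes _ = ℕₚ.≤-refl
    ... | no _  = ℕₚ.m≤n⇒m≤1+n (extTime≤time inv extracted-v)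
    insTime<extTime′ : ∀ {v} → extracted st′ v ≡ true → insTime st v < extTime st′ v
    insTime<extTime′ {v} extracted-v with v ≟ᶠ u
    ... | yes refl = s≤s (insTime≤time inv inserted-u)
    ... | no _     = insTime<extTime inv extracted-v
    parent-extTime<insTime′ : ∀ {w v} → parent st v ≡ just w → extTime st′ w < insTime st v
    parent-extTime<insTime′ {w} pv with w ≟ᶠ u
    ... | yes refl with () ← trans (sym (parent-extracted inv pv)) not-extracted-u
    ... | no _     = parent-extTime<insTime inv pv

  invariant-insert : ∀ {st u v} → Invariant st → extracted st u ≡ true → inserted st v ≡ false → Arc G u v →
                     Invariant (insertV st u v)
  invariant-insert {st} {u} {v} inv extracted-u fresh-v arc = record
    { root-inserted          = trans (upd-other (inserted st) v true s≢v) (root-inserted inv)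
    ; root-parentless        = trans (upd-other (parent st) v (just u) s≢v) (root-parentless inv)
    ; extracted⇒inserted     = λ extracted-x →
        trans (upd-other (inserted st) v true (extracted≢v extracted-x)) (extracted⇒inserted inv extracted-x)
    ; inserted⇒root-or-child = inserted⇒root-or-child′
    ; parent-arc             = parent-arc′
    ; parent-extracted       = parent-extracted′
    ; insTime≤time           = insTime≤time′
    ; extTime≤time           = ℕₚ.m≤n⇒m≤1+n ∘ extTime≤time inv
    ; insTime<extTime        = λ {x} extracted-x →
        subst (_< extTime st x) (sym (upd-other (insTime st) v _ (extracted≢v extracted-x))) (insTime<extTime inv extracted-x)
    ; parent-extTime<insTime = parent-extTime<insTime′
    }
    where
    st′ : State n
    st′ = insertV st u v
    ≢v : ∀ {x} → inserted st x ≡ true → x ≢ v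
    ≢v inserted-x refl with () ← trans (sym inserted-x) fresh-v
    s≢v : s ≢ v
    s≢v = ≢v (root-inserted inv)
    extracted≢v : ∀ {x} → extracted st x ≡ true → x ≢ v
    extracted≢v = ≢v ∘ extracted⇒inserted inv
    inserted⇒root-or-child′ : ∀ {x} → inserted st′ x ≡ true → x ≡ s ⊎ ∃[ w ] parent st′ x ≡ just w
    inserted⇒root-or-child′ {x} inserted-x with x ≟ᶠ v
    ... | yes _ = inj₂ (u , refl)
    ... | no _  = inserted⇒root-or-child inv inserted-x
    parent-arc′ : ∀ {w x} → parent st′ x ≡ just w → Arc G w x
    parent-arc′ {x = x} px with x ≟ᶠ v
    parent-arc′ refl | yes refl = arc
    parent-arc′ px   | no _     = parent-arc inv px
    parent-extracted′ : ∀ {w x} → parent st′ x ≡ just w → extracted st w ≡ true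
    parent-extracted′ {x = x} px with x ≟ᶠ v
    parent-extracted′ refl | yes _ = extracted-u
    parent-extracted′ px   | no _  = parent-extracted inv px
    insTime≤time′ : ∀ {x} → inserted st′ x ≡ true → insTime st′ x ≤ time st′
    insTime≤time′ {x} inserted-x with x ≟ᶠ v
    ... | yes _ = ℕₚ.≤-refl
    ... | no _  = ℕₚ.m≤n⇒m≤1+n (insTime≤time inv inserted-x)
    parent-extTime<insTime′ : ∀ {w x} → parent st′ x ≡ just w → extTime st w < insTime st′ x
    parent-extTime<insTime′ {x = x} px with x ≟ᶠ v
    parent-extTime<insTime′ refl | yes _ = s≤s (extTime≤time inv extracted-u)
    parent-extTime<insTime′ px   | no _  = parent-extTime<insTime inv px

  invariant-rekey : ∀ {st} (keys : Fin n → Maybe ℚ) → Invariant st → Invariant (record st { D = keys })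
  invariant-rekey keys inv = record { Invariant inv }

  record InsertionsOnly (st st′ : State n) : Set where
    field
      inserted-mono  : ∀ {v} → inserted st v ≡ true → inserted st′ v ≡ true
      extracted-same : ∀ v → extracted st′ v ≡ extracted st v
  open InsertionsOnly

  insertionsOnly-refl : ∀ {st} → InsertionsOnly st st
  insertionsOnly-refl = record { inserted-mono = λ inserted-v → inserted-v ; extracted-same = λ _ → refl }

  insertionsOnly-rekey : ∀ {st} (keys : Fin n → Maybe ℚ) → InsertionsOnly st (record st { D = keys })
  insertionsOnly-rekey keys = record { inserted-mono = λ inserted-v → inserted-v ; extracted-same = λ _ → refl }

  insertionsOnly-trans : ∀ {st st′ st″} → InsertionsOnly st st′ → InsertionsOnly st′ st″ → InsertionsOnly st st″
  insertionsOnly-trans p q = record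
    { inserted-mono  = inserted-mono q ∘ inserted-mono p
    ; extracted-same = λ v → trans (extracted-same q v) (extracted-same p v)
    }

  relax-preserves : ∀ {st} u du {v} w → Invariant st → extracted st u ≡ true → Arc G u v →
                    let st′ = relax u du st (v , w) in Invariant st′ × InsertionsOnly st st′ × inserted st′ v ≡ true
  relax-preserves {st} u du {v} w inv extracted-u arc with extracted st v in extracted-v
  ... | true  = inv , insertionsOnly-refl , extracted⇒inserted inv extracted-v
  ... | false with inserted st v in inserted-v
  ...   | true  = invariant-rekey _ inv , insertionsOnly-rekey _ , inserted-v
  ...   | false = invariant-rekey _ (invariant-insert inv extracted-u inserted-v arc)
                , record { inserted-mono = λ {x} → grows x ; extracted-same = λ _ → refl }
                , upd-same (inserted st) v true
    where
    grows : ∀ x → inserted st x ≡ true → upd (inserted st) v true x ≡ true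
    grows x inserted-x with x ≟ᶠ v
    ... | yes _ = refl
    ... | no _  = inserted-x

  processEdges-preserves : ∀ {st} u du es → Invariant st → extracted st u ≡ true → All (λ e → Arc G u (proj₁ e)) es →
                           let st′ = processEdges u du st es in
                           Invariant st′ × InsertionsOnly st st′ × All (λ e → inserted st′ (proj₁ e) ≡ true) es
  processEdges-preserves u du []             inv extracted-u []           = inv , insertionsOnly-refl , []
  processEdges-preserves u du ((v , w) ∷ es) inv extracted-u (arc ∷ arcs) with relax-preserves u du w inv extracted-u arc
  ... | inv₁ , ins₁ , inserted₁ with processEdges-preserves u du es inv₁ (trans (extracted-same ins₁ _) extracted-u) arcs
  ...   | inv₂ , ins₂ , inserted₂ = inv₂ , insertionsOnly-trans ins₁ ins₂ , inserted-mono ins₂ inserted₁ ∷ inserted₂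

  outArcs-sound : ∀ {u v w} → (v , w) ∈ outArcs G u → Arc G u v
  outArcs-sound {u} vw∈ with ∈-map∘filter⁻ proj₂ (λ e → proj₁ e ≟ᶠ u) vw∈
  ... | _ , e∈ , refl , refl = lose e∈ (refl , refl)

  outArcs-complete : ∀ {u v} → Arc G u v → ∃[ w ] (v , w) ∈ outArcs G u
  outArcs-complete {u} arc with find arc
  ... | (_ , _ , w) , e∈ , refl , refl = w , ∈-map∘filter⁺ proj₂ (λ e → proj₁ e ≟ᶠ u) (_ , e∈ , refl , refl)

  -- Not part of Invariant: it fails while the edges of the extracted vertex are being processed.
  Closed : State n → Set
  Closed st = ∀ {u v} → extracted st u ≡ true → Arc G u v → inserted st v ≡ true

  run-invariant : ∀ {st} → Run G s st → Invariant st × Closed st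
  run-invariant start = invariant-init , λ ()
  run-invariant (extract {st} u du order run in-queue _ _ order↭) with run-invariant run
  ... | inv , closed with processEdges-preserves u du order (invariant-extract inv in-queue) (upd-same (extracted st) u true)
                            (All.tabulate (λ e∈ → outArcs-sound (∈-resp-↭ order↭ e∈)))
  ...   | inv′ , insertions , targets-inserted = inv′ , closed′
    where
    closed′ : Closed (processEdges u du (extractV st u) order)
    closed′ {x} {v} extracted-x arc with x ≟ᶠ u
    ... | yes refl = All.lookup targets-inserted (∈-resp-↭ (↭-sym order↭) (proj₂ (outArcs-complete arc)))
    ... | no x≢u   = inserted-mono insertions (closed extracted-before arc)
      where
      extracted-before : extracted st x ≡ true
      extracted-before =
        trans (sym (upd-other (extracted st) u true x≢u)) (trans (sym (extracted-same insertions x)) extracted-x)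

module FinishedRun {n : ℕ} {G : Graph n} {s : Fin n} (reachable : ∀ v → Reachable G s v)
                   {st : State n} (run : Run G s st) (finished : Finished st) where
  open DijkstraInvariant G s
  open Invariant (proj₁ (run-invariant run))

  inserted⇒extracted : ∀ {v} → inserted st v ≡ true → extracted st v ≡ true
  inserted⇒extracted {v} inserted-v with extracted st v in extracted-v
  ... | true  = refl
  ... | false = contradiction (inserted-v , extracted-v) (finished v)

  reachable⇒inserted : ∀ {v} → Reachable G s v → inserted st v ≡ true
  reachable⇒inserted here            = root-inserted
  reachable⇒inserted (step path arc) = proj₂ (run-invariant run) (inserted⇒extracted (reachable⇒inserted path)) arc

  all-extracted : ∀ v → extracted st v ≡ true
  all-extracted v = inserted⇒extracted (reachable⇒inserted (reachable v))

  parent-extTime< : ∀ {u v} → parent st v ≡ just u → extTime st u < extTime st v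
  parent-extTime< {v = v} pv = ℕₚ.<-trans (parent-extTime<insTime pv) (insTime<extTime (all-extracted v))

  open RankedParents (parent st) (extTime st) parent-extTime<

  exploration-tree-spanning : IsSpanningTree G s (parent st)
  exploration-tree-spanning =
      root-parentless
    , (λ v → Sum.map₂ (λ { (u , pv) → subst (λ m → ArcFrom G m v) (sym pv) (parent-arc pv) }) (root-or-child v))
    , reaches-root root-or-child
    where
    root-or-child : ∀ v → v ≡ s ⊎ ∃[ u ] parent st v ≡ just u
    root-or-child v = inserted⇒root-or-child (reachable⇒inserted (reachable v))

  ancestor-extTime<insTime : ∀ {u v} → Ancestor (parent st) u v → extTime st u < insTime st v
  ancestor-extTime<insTime ancestor with ancestor-via-parent (parent st) ancestor
  ... | w , pv , k , w↑u = ℕₚ.≤-<-trans (rank-iterParent-≤ k w↑u) (parent-extTime<insTime pv)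

mainTheorem10 : ∃[ K ] (∀ (n : ℕ) (G : Graph n) (s : Fin n) → PositiveWeights G → (∀ v → Reachable G s v) → (st : State n) → Run G s st → Finished st → (k : ℕ) (C : Fin n → Fin k) → IsIntersectingColoring (insTime st) (extTime st) C → (LinTree (parent st) ≤ LinGraph G s) × (twoPowEnergy C ≤ LinTree (parent st) ^ K))
mainTheorem10 = 4 , λ n G s _ reachable st run finished k C coloring →
  let open FinishedRun reachable run finished
      factorials≤Lin = ∏-colorCount-!≤LinTree (parent st) (insTime st) (extTime st) C ancestor-extTime<insTime coloring
  in LinTree≤LinGraph exploration-tree-spanning
   , ℕₚ.≤-trans (twoPowEnergy≤∏-colorCount-!^4 C) (ℕₚ.^-monoˡ-≤ 4 factorials≤Lin)
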